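{- Modulo $5$: $v(0)\equiv 1$, $v(1)\equiv 1$, $v(2)\equiv 2$, and $v(n)\equiv 0$ for all $n\ge 3$; and $u(0)\equiv u(1)\equiv u(2)\equiv 1$, and $u(n)\equiv 0$ for all $n\ge 3$.
   Context: Define integer sequences $u,v$ by $u(0)=v(0)=1$ and, for $n\ge 1$, $u(n)=\Big(\prod_{j=1}^{n}(4j-1)\Big)^2-\sum_{m=0}^{n-1}\binom{2n+1}{2m+1}\Big(\prod_{j=1}^{n-m}(4j-3)\Big)^2u(m)$, $v(n)=2^{n-1}\Big(\prod_{j=1}^{n}(4j-3)\Big)^2-\frac12\sum_{m=1}^{n-1}\binom{2n}{2m}v(m)v(n-m)$. -}

module Defs where

open import Data.Nat as ℕ using (ℕ; zero; suc)
open import Data.Nat.Combinatorics using (_C_)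
open import Data.Integer as ℤ using (ℤ; +_; _-_; _*_; _+_)
open import Data.Integer.DivMod using (_/_)
open import Relation.Nullary using (yes; no)

-- Π_{j=1}^{n} (4j - c), computed in ℕ (for c ≤ 3 every factor 4j - c is positive)
prod4 : ℕ → ℕ → ℕ
prod4 c zero    = 1
prod4 c (suc n) = prod4 c n ℕ.* (4 ℕ.* suc n ℕ.∸ c)

Σ< : ℕ → (ℕ → ℤ) → ℤ
Σ< zero    f = + 0
Σ< (suc k) f = Σ< k f + f k

Σ1 : ℕ → (ℕ → ℤ) → ℤ
Σ1 n f = Σ< (n ℕ.∸ 1) (λ i → f (suc i))

extend : (ℕ → ℤ) → ℕ → ℤ → (ℕ → ℤ)
extend t n x m with m ℕ.≟ n
... | yes _ = x
... | no  _ = t m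

-- uTab n m = u(m) for m ≤ n (course-of-values recursion)
uStep : ℕ → (ℕ → ℤ) → ℤ
uStep n u = + (prod4 1 n ℕ.^ 2)
          - Σ< n (λ m → + ((2 ℕ.* n ℕ.+ 1) C (2 ℕ.* m ℕ.+ 1)) * + (prod4 3 (n ℕ.∸ m) ℕ.^ 2) * u m)

uTab : ℕ → (ℕ → ℤ)
uTab zero    = λ _ → + 1
uTab (suc n) = extend (uTab n) (suc n) (uStep (suc n) (uTab n))

u : ℕ → ℤ
u n = uTab n n

-- v(n) = 2^{n-1} P^2 - (1/2) Σ_{m=1}^{n-1} C(2n,2m) v(m) v(n-m), for n ≥ 1.
-- Written as (2^n P^2 - Σ ...) / 2; the numerator is always even
-- (the sum is symmetric under m ↦ n-m), so the division is exact.
vStep : ℕ → (ℕ → ℤ) → ℤ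
vStep n v = (+ (2 ℕ.^ n ℕ.* prod4 3 n ℕ.^ 2)
            - Σ1 n (λ m → + ((2 ℕ.* n) C (2 ℕ.* m)) * v m * v (n ℕ.∸ m))) / + 2

vTab : ℕ → (ℕ → ℤ)
vTab zero    = λ _ → + 1
vTab (suc n) = extend (vTab n) (suc n) (vStep (suc n) (vTab n))

v : ℕ → ℤ
v n = vTab n n

{-# OPTIONS --safe #-}
-- Once n is large the recursions only add multiples of 5: 5 = 4·2 − 3 divides ∏(4j − 3)
-- for n ≥ 2, and 15 = 4·4 − 1 divides ∏(4j − 1) for n ≥ 4. In u(n+1), n ≥ 3, the summand
-- m = n carries u(n) and every other summand carries ∏_{j ≤ n+1−m}(4j − 3)². In the numerator
-- of v(n+1), n ≥ 4, each product v(m) v(n+1−m) has an index ≥ 3. That numerator is even,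
-- its sum being palindromic with the even central binomial coefficient in the middle, so the
-- halving in v keeps the factor 5. The remaining cases are evaluated.
module Submission where

open import Defs
open import Data.Nat using (ℕ; zero; suc; NonZero; _+_; _*_; _∸_; _^_; _≤_; _<_; _≥_; z≤n; s≤s; _≤?_)
import Data.Nat.Properties as ℕₚ
import Data.Nat.Divisibility as ℕ
open import Data.Nat.Coprimality using (Coprime; coprime-divisor; gcd≡1⇒coprime)
open import Data.Nat.Combinatorics using (_C_; nCk≡nC[n∸k]; nCk+nC[k+1]≡[n+1]C[k+1])
open import Data.Nat.Induction using (<-rec)
open import Data.Integer as ℤ using (ℤ; +_; _-_; ∣_∣)
import Data.Integer.Properties as ℤₚ
open import Data.Integer.Divisibility using (_∣_)
open import Data.Integer.Divisibility.Signed
  using (divides; ∣ᵤ⇒∣; ∣⇒∣ᵤ; ∣m∣n⇒∣m+n; ∣m∣n⇒∣m-n; ∣m+n∣n⇒∣m; ∣m⇒∣m*n; ∣n⇒∣m*n)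
  renaming (_∣_ to _∣ₛ_)
open import Data.Integer.DivMod using (_/_; _%_; a≡a%n+[a/n]*n; n%d<d)
open import Data.Integer.Tactic.RingSolver using (solve-∀)
open import Data.Product using (_×_; _,_)
open import Data.Sum using (inj₁; inj₂)
open import Function using (_∘_)
open import Relation.Nullary using (yes; no; contradiction)
open import Relation.Nullary.Decidable using (True; toWitness)
open import Relation.Binary.PropositionalEquality
open ≡-Reasoning

∣-by-evaluation : ∀ d x → {True (d ℕ.∣? ∣ x ∣)} → + d ∣ x
∣-by-evaluation d x {d∣x} = toWitness d∣x

≥-by-offset : {P : ℕ → Set} → ∀ m → (∀ k → P (m + k)) → ∀ n → n ≥ m → P n
≥-by-offset m P[m+_] n m≤n with k , refl ← ℕₚ.m≤n⇒∃[o]m+o≡n m≤n = P[m+ k ]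

Σ<-∣ : ∀ {d} k (f : ℕ → ℤ) → (∀ m → m < k → d ∣ₛ f m) → d ∣ₛ Σ< k f
Σ<-∣ {d} zero    f _   = divides (+ 0) (sym (ℤₚ.*-zeroˡ d))
Σ<-∣     (suc k) f d∣f =
  ∣m∣n⇒∣m+n (Σ<-∣ k f (λ m m<k → d∣f m (ℕₚ.m<n⇒m<1+n m<k))) (d∣f k ℕₚ.≤-refl)

Σ<-unfoldˡ : ∀ k (f : ℕ → ℤ) → Σ< (suc k) f ≡ f 0 ℤ.+ Σ< k (f ∘ suc)
Σ<-unfoldˡ zero    f = trans (ℤₚ.+-identityˡ (f 0)) (sym (ℤₚ.+-identityʳ (f 0)))
Σ<-unfoldˡ (suc k) f = trans (cong (ℤ._+ f (suc k)) (Σ<-unfoldˡ k f)) (ℤₚ.+-assoc (f 0) _ _)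

-- Pair the first summand with the last one and recurse on the inner range.
Σ<-palindrome-even : ∀ k (f : ℕ → ℤ) →
                     (∀ i j → suc (i + j) ≡ k → f i ≡ f j) →
                     (∀ i → suc (i + i) ≡ k → + 2 ∣ₛ f i) →
                     + 2 ∣ₛ Σ< k f
Σ<-palindrome-even zero          f _   _      = divides (+ 0) refl
Σ<-palindrome-even (suc zero)    f _   middle =
  subst (+ 2 ∣ₛ_) (sym (ℤₚ.+-identityˡ (f 0))) (middle 0 refl)
Σ<-palindrome-even (suc (suc k)) f mirror middle =
  subst (+ 2 ∣ₛ_) (sym sum≡) (∣m∣n⇒∣m+n inner (divides (f 0) refl))
  where
  shift : ∀ {i j} → suc (i + j) ≡ k → suc (suc i + suc j) ≡ suc (suc k)
  shift {i} {j} e = cong (suc ∘ suc) (trans (ℕₚ.+-suc i j) e)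

  inner : + 2 ∣ₛ Σ< k (f ∘ suc)
  inner = Σ<-palindrome-even k (f ∘ suc)
    (λ i j e → mirror (suc i) (suc j) (shift e)) (λ i e → middle (suc i) (shift e))

  sum≡ : Σ< (suc (suc k)) f ≡ Σ< k (f ∘ suc) ℤ.+ f 0 ℤ.* + 2
  sum≡ = begin
    Σ< (suc k) f ℤ.+ f (suc k)             ≡⟨ cong₂ ℤ._+_ (Σ<-unfoldˡ k f) (sym (mirror 0 (suc k) refl)) ⟩
    (f 0 ℤ.+ Σ< k (f ∘ suc)) ℤ.+ f 0       ≡⟨ rearrange (f 0) (Σ< k (f ∘ suc)) ⟩
    Σ< k (f ∘ suc) ℤ.+ f 0 ℤ.* + 2         ∎
    where
    rearrange : ∀ a b → (a ℤ.+ b) ℤ.+ a ≡ b ℤ.+ a ℤ.* + 2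
    rearrange = solve-∀

∣∧<⇒≡0 : ∀ {d r} → d ℕ.∣ r → r < d → r ≡ 0
∣∧<⇒≡0 {r = zero}  _   _   = refl
∣∧<⇒≡0 {r = suc _} d∣r r<d = contradiction d∣r (ℕ.>⇒∤ r<d)

[q*2]/2≡q : ∀ q → (q ℤ.* + 2) / + 2 ≡ q
[q*2]/2≡q q = ℤₚ.*-cancelʳ-≡ _ q (+ 2) (begin
  Q ℤ.* + 2           ≡⟨ ℤₚ.+-identityˡ _ ⟨
  + 0 ℤ.+ Q ℤ.* + 2   ≡⟨ cong (λ r → + r ℤ.+ Q ℤ.* + 2) r≡0 ⟨
  + r ℤ.+ Q ℤ.* + 2   ≡⟨ a≡a%n+[a/n]*n (q ℤ.* + 2) (+ 2) ⟨
  q ℤ.* + 2           ∎)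
  where
  Q = (q ℤ.* + 2) / + 2
  r = (q ℤ.* + 2) % + 2
  2∣r : + 2 ∣ₛ + r
  2∣r = ∣m+n∣n⇒∣m (subst (+ 2 ∣ₛ_) (a≡a%n+[a/n]*n (q ℤ.* + 2) (+ 2)) (divides q refl))
                  (divides Q refl)
  r≡0 : r ≡ 0
  r≡0 = ∣∧<⇒≡0 (∣⇒∣ᵤ 2∣r) (n%d<d (q ℤ.* + 2) (+ 2))

∣-half : ∀ {k} N → Coprime k 2 → + 2 ∣ₛ N → + k ∣ₛ N → + k ∣ₛ N / + 2
∣-half {k} _ k⊥2 (divides q refl) k∣2q rewrite [q*2]/2≡q q =
  ∣ᵤ⇒∣ (coprime-divisor k⊥2 (subst (k ℕ.∣_) ∣2q∣≡2∣q∣ (∣⇒∣ᵤ k∣2q)))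
  where
  ∣2q∣≡2∣q∣ : ∣ q ℤ.* + 2 ∣ ≡ 2 * ∣ q ∣
  ∣2q∣≡2∣q∣ = trans (ℤₚ.abs-* q (+ 2)) (ℕₚ.*-comm ∣ q ∣ 2)

5⊥2 : Coprime 5 2
5⊥2 = gcd≡1⇒coprime refl

prod4-∣-mono : ∀ c {m n} → m ≤ n → prod4 c m ℕ.∣ prod4 c n
prod4-∣-mono c {n = zero}  z≤n   = ℕ.∣-refl
prod4-∣-mono c {n = suc n} m≤1+n with ℕₚ.m≤n⇒m<n∨m≡n m≤1+n
... | inj₂ refl  = ℕ.∣-refl
... | inj₁ m<1+n = ℕ.∣m⇒∣m*n _ (prod4-∣-mono c (ℕₚ.≤-pred m<1+n))

5∣prod4-3 : ∀ {n} → 2 ≤ n → 5 ℕ.∣ prod4 3 n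
5∣prod4-3 = prod4-∣-mono 3

5∣prod4-1 : ∀ {n} → 4 ≤ n → 5 ℕ.∣ prod4 1 n
5∣prod4-1 4≤n = ℕ.∣-trans (ℕ.divides 693 refl) (prod4-∣-mono 1 4≤n)

C-swap : ∀ a b → (a + b) C a ≡ (a + b) C b
C-swap a b = trans (nCk≡nC[n∸k] (ℕₚ.m≤m+n a b)) (cong ((a + b) C_) (ℕₚ.m+n∸m≡n a b))

central-binomial-even : ∀ n .{{_ : NonZero n}} → 2 ℕ.∣ (n + n) C n
central-binomial-even (suc n) = ℕ.divides (N C n) (begin
  suc N C suc n       ≡⟨ nCk+nC[k+1]≡[n+1]C[k+1] N n ⟨
  N C n + N C suc n   ≡⟨ cong (λ x → N C n + x) (C-swap n (suc n)) ⟨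
  N C n + N C n       ≡⟨ cong (λ x → N C n + x) (ℕₚ.+-identityʳ (N C n)) ⟨
  2 * (N C n)         ≡⟨ ℕₚ.*-comm 2 (N C n) ⟩
  (N C n) * 2         ∎)
  where N = n + suc n

extend-≡ : ∀ t n x → extend t n x n ≡ x
extend-≡ t n x with n ℕₚ.≟ n
... | yes _  = refl
... | no n≢n = contradiction refl n≢n

extend-≢ : ∀ t n x {m} → m ≢ n → extend t n x m ≡ t m
extend-≢ t n x {m} m≢n with m ℕₚ.≟ n
... | yes m≡n = contradiction m≡n m≢n
... | no _    = refl

u-suc : ∀ n → u (suc n) ≡ uStep (suc n) (uTab n)
u-suc n = extend-≡ (uTab n) (suc n) _

v-suc : ∀ n → v (suc n) ≡ vStep (suc n) (vTab n)
v-suc n = extend-≡ (vTab n) (suc n) _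

vTab-correct : ∀ {m n} → m ≤ n → vTab n m ≡ v m
vTab-correct {n = zero}  z≤n   = refl
vTab-correct {n = suc n} m≤1+n with ℕₚ.m≤n⇒m<n∨m≡n m≤1+n
... | inj₂ refl  = refl
... | inj₁ m<1+n =
  trans (extend-≢ (vTab n) (suc n) _ (ℕₚ.<⇒≢ m<1+n)) (vTab-correct (ℕₚ.≤-pred m<1+n))

uWeight : ℕ → ℕ → ℤ
uWeight n m = + ((2 * n + 1) C (2 * m + 1)) ℤ.* + (prod4 3 (n ∸ m) ^ 2)

uSummand : ℕ → (ℕ → ℤ) → ℕ → ℤ
uSummand n t m = uWeight n m ℤ.* t m

uSummand-5∣ : ∀ n t {m} → + 5 ∣ₛ t n → m < suc n → + 5 ∣ₛ uSummand (suc n) t m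
uSummand-5∣ n t {m} 5∣tn m<1+n with ℕₚ.m≤n⇒m<n∨m≡n (ℕₚ.≤-pred m<1+n)
... | inj₂ refl = ∣n⇒∣m*n (uWeight (suc n) n) 5∣tn
... | inj₁ m<n  = ∣m⇒∣m*n (t m) (∣n⇒∣m*n (+ ((2 * suc n + 1) C (2 * m + 1)))
                                           (∣ᵤ⇒∣ (ℕ.∣m⇒∣m*n _ (5∣prod4-3 2≤1+n∸m))))
  where
  2≤1+n∸m : 2 ≤ suc n ∸ m
  2≤1+n∸m = subst (2 ≤_) (sym (ℕₚ.+-∸-assoc 1 (ℕₚ.<⇒≤ m<n))) (s≤s (ℕₚ.m<n⇒0<n∸m m<n))

uStep-5∣ : ∀ n t → 3 ≤ n → + 5 ∣ₛ t n → + 5 ∣ₛ uStep (suc n) t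
uStep-5∣ n t 3≤n 5∣tn =
  ∣m∣n⇒∣m-n 5∣P² (Σ<-∣ (suc n) (uSummand (suc n) t) (λ m → uSummand-5∣ n t 5∣tn))
  where
  5∣P² : + 5 ∣ₛ + (prod4 1 (suc n) ^ 2)
  5∣P² = ∣ᵤ⇒∣ (ℕ.∣m⇒∣m*n _ (5∣prod4-1 (s≤s 3≤n)))

u[3+k]-5∣ : ∀ k → + 5 ∣ₛ u (3 + k)
u[3+k]-5∣ zero    = ∣ᵤ⇒∣ (∣-by-evaluation 5 (u 3))
u[3+k]-5∣ (suc k) = subst (+ 5 ∣ₛ_) (sym (u-suc (3 + k)))
  (uStep-5∣ (3 + k) (uTab (3 + k)) (ℕₚ.m≤m+n 3 k) (u[3+k]-5∣ k))

vWeight : ℕ → ℕ → ℤ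
vWeight n m = + ((2 * n) C (2 * m))

vSummand : ℕ → (ℕ → ℤ) → ℕ → ℤ
vSummand n t m = vWeight n m ℤ.* t m ℤ.* t (n ∸ m)

vNumerator : ℕ → (ℕ → ℤ) → ℤ
vNumerator n t = + (2 ^ n * prod4 3 n ^ 2) - Σ1 n (vSummand n t)

vSummand-swap : ∀ t i j → vSummand (i + j) t i ≡ vSummand (i + j) t j
vSummand-swap t i j = begin
  + (N C (2 * i)) ℤ.* t i ℤ.* t (i + j ∸ i)
    ≡⟨ cong₂ (λ c s → + c ℤ.* t i ℤ.* t s) binomial-swap (ℕₚ.m+n∸m≡n i j) ⟩
  + (N C (2 * j)) ℤ.* t i ℤ.* t j
    ≡⟨ swap-last (+ (N C (2 * j))) (t i) (t j) ⟩
  + (N C (2 * j)) ℤ.* t j ℤ.* t i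
    ≡⟨ cong (λ s → + (N C (2 * j)) ℤ.* t j ℤ.* t s) (ℕₚ.m+n∸n≡m i j) ⟨
  + (N C (2 * j)) ℤ.* t j ℤ.* t (i + j ∸ j)
    ∎
  where
  N = 2 * (i + j)
  binomial-swap : N C (2 * i) ≡ N C (2 * j)
  binomial-swap = subst (λ M → M C (2 * i) ≡ M C (2 * j))
                        (sym (ℕₚ.*-distribˡ-+ 2 i j)) (C-swap (2 * i) (2 * j))
  swap-last : ∀ x a b → x ℤ.* a ℤ.* b ≡ x ℤ.* b ℤ.* a
  swap-last = solve-∀

vSummand-middle-even : ∀ t i → + 2 ∣ₛ vSummand (suc i + suc i) t (suc i)
vSummand-middle-even t i =
  ∣m⇒∣m*n (t (suc i + suc i ∸ suc i)) (∣m⇒∣m*n (t (suc i)) 2∣binomial)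
  where
  2∣binomial : + 2 ∣ₛ vWeight (suc i + suc i) (suc i)
  2∣binomial = ∣ᵤ⇒∣ (subst (λ M → 2 ℕ.∣ M C (2 * suc i))
                           (sym (ℕₚ.*-distribˡ-+ 2 (suc i) (suc i)))
                           (central-binomial-even (2 * suc i)))

vNumerator-even : ∀ n t → + 2 ∣ₛ vNumerator (suc n) t
vNumerator-even n t =
  ∣m∣n⇒∣m-n 2∣leading (Σ<-palindrome-even n (vSummand (suc n) t ∘ suc) mirror middle)
  where
  2∣leading : + 2 ∣ₛ + (2 ^ suc n * prod4 3 (suc n) ^ 2)
  2∣leading = ∣ᵤ⇒∣ (ℕ.∣m⇒∣m*n _ (ℕ.m∣m*n (2 ^ n)))

  reindex : ∀ {i j} → suc (i + j) ≡ n → suc i + suc j ≡ suc n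
  reindex {i} {j} e = cong suc (trans (ℕₚ.+-suc i j) e)

  mirror : ∀ i j → suc (i + j) ≡ n → vSummand (suc n) t (suc i) ≡ vSummand (suc n) t (suc j)
  mirror i j e = subst (λ M → vSummand M t (suc i) ≡ vSummand M t (suc j))
                       (reindex e) (vSummand-swap t (suc i) (suc j))

  middle : ∀ i → suc (i + i) ≡ n → + 2 ∣ₛ vSummand (suc n) t (suc i)
  middle i e = subst (λ M → + 2 ∣ₛ vSummand M t (suc i)) (reindex e) (vSummand-middle-even t i)

vSummand-5∣ : ∀ n t → 4 ≤ n → (∀ m → 3 ≤ m → m ≤ n → + 5 ∣ₛ t m) →
              ∀ i → i < n → + 5 ∣ₛ vSummand (suc n) t (suc i)
vSummand-5∣ n t 4≤n 5∣t i i<n with 3 ≤? suc i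
... | yes 3≤1+i =
  ∣m⇒∣m*n (t (n ∸ i)) (∣n⇒∣m*n (vWeight (suc n) (suc i)) (5∣t (suc i) 3≤1+i i<n))
... | no  3≰1+i =
  ∣n⇒∣m*n (vWeight (suc n) (suc i) ℤ.* t (suc i)) (5∣t (n ∸ i) 3≤n∸i (ℕₚ.m∸n≤m n i))
  where
  3≤n∸i : 3 ≤ n ∸ i
  3≤n∸i = ℕₚ.≤-trans (ℕₚ.∸-monoˡ-≤ 1 4≤n) (ℕₚ.∸-monoʳ-≤ n (ℕₚ.≤-pred (ℕₚ.≤-pred (ℕₚ.≰⇒> 3≰1+i))))

vNumerator-5∣ : ∀ n t → 4 ≤ n → (∀ m → 3 ≤ m → m ≤ n → + 5 ∣ₛ t m) →
                + 5 ∣ₛ vNumerator (suc n) t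
vNumerator-5∣ n t 4≤n 5∣t =
  ∣m∣n⇒∣m-n 5∣leading (Σ<-∣ n (vSummand (suc n) t ∘ suc) (vSummand-5∣ n t 4≤n 5∣t))
  where
  5∣leading : + 5 ∣ₛ + (2 ^ suc n * prod4 3 (suc n) ^ 2)
  5∣leading = ∣ᵤ⇒∣ (ℕ.∣n⇒∣m*n (2 ^ suc n) (ℕ.∣m⇒∣m*n _
                (5∣prod4-3 (ℕₚ.≤-trans (ℕₚ.m≤n+m 2 2) (ℕₚ.m≤n⇒m≤1+n 4≤n)))))

vStep-5∣ : ∀ n t → 4 ≤ n → (∀ m → 3 ≤ m → m ≤ n → + 5 ∣ₛ t m) → + 5 ∣ₛ vStep (suc n) t
vStep-5∣ n t 4≤n 5∣t =
  ∣-half (vNumerator (suc n) t) 5⊥2 (vNumerator-even n t) (vNumerator-5∣ n t 4≤n 5∣t)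

v-5∣ : ∀ n → 3 ≤ n → + 5 ∣ₛ v n
v-5∣ = <-rec (λ n → 3 ≤ n → + 5 ∣ₛ v n) step
  where
  step : ∀ n → (∀ {m} → m < n → 3 ≤ m → + 5 ∣ₛ v m) → 3 ≤ n → + 5 ∣ₛ v n
  step 0 _ ()
  step 1 _ (s≤s ())
  step 2 _ (s≤s (s≤s ()))
  step 3 _ _ = ∣ᵤ⇒∣ (∣-by-evaluation 5 (v 3))
  step 4 _ _ = ∣ᵤ⇒∣ (∣-by-evaluation 5 (v 4))
  step (suc n@(suc (suc (suc (suc _))))) ih _ =
    subst (+ 5 ∣ₛ_) (sym (v-suc n)) (vStep-5∣ n (vTab n) (s≤s (s≤s (s≤s (s≤s z≤n))))
      (λ m 3≤m m≤n → subst (+ 5 ∣ₛ_) (sym (vTab-correct m≤n)) (ih (s≤s m≤n) 3≤m)))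

lemma11 : ((+ 5) ∣ (v 0 - + 1)) × ((+ 5) ∣ (v 1 - + 1)) × ((+ 5) ∣ (v 2 - + 2))
          × (∀ (n : ℕ) → n ≥ 3 → (+ 5) ∣ v n)
          × ((+ 5) ∣ (u 0 - + 1)) × ((+ 5) ∣ (u 1 - + 1)) × ((+ 5) ∣ (u 2 - + 1))
          × (∀ (n : ℕ) → n ≥ 3 → (+ 5) ∣ u n)
lemma11 =
    ∣-by-evaluation 5 (v 0 - + 1) , ∣-by-evaluation 5 (v 1 - + 1) , ∣-by-evaluation 5 (v 2 - + 2)
  , (λ n 3≤n → ∣⇒∣ᵤ (v-5∣ n 3≤n))
  , ∣-by-evaluation 5 (u 0 - + 1) , ∣-by-evaluation 5 (u 1 - + 1) , ∣-by-evaluation 5 (u 2 - + 1)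
  , ≥-by-offset 3 (∣⇒∣ᵤ ∘ u[3+k]-5∣)
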